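{- There is no $5\times 5$ normalized weak Hadamard matrix whose columns are pairwise orthogonal.
   Context: A weak Hadamard matrix is a real $n\times n$ matrix $P$ with all entries in $\{ -1,0,1\}$ such that $P^TP$ is tridiagonal. It is normalized if its first row and its first column consist entirely of $1$'s. -}

module Defs where

open import Data.Nat using (ℕ; suc)
open import Data.Fin using (Fin; zero; toℕ)
open import Data.Integer using (ℤ; +_; -[1+_]; _+_; _*_; 0ℤ; 1ℤ; -1ℤ)
open import Data.Sum using (_⊎_)
open import Data.Product using (_×_)
open import Relation.Binary.PropositionalEquality using (_≡_)
open import Relation.Nullary using (¬_)
open import Data.Vec.Functional using (Vector)
open import Data.Vec.Functional using () renaming (foldr to vfoldr)

-- An n×n integer matrix: rows indexed by the first argument, columns by the second.
Matrix : ℕ → Set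
Matrix n = Fin n → Fin n → ℤ

Σℤ : ∀ {n} → (Fin n → ℤ) → ℤ
Σℤ f = vfoldr _+_ 0ℤ f

transpose : ∀ {n} → Matrix n → Matrix n
transpose P i j = P j i

_⊗_ : ∀ {n} → Matrix n → Matrix n → Matrix n
(A ⊗ B) i j = Σℤ (λ k → A i k * B k j)

Ternary : ∀ {n} → Matrix n → Set
Ternary P = ∀ i j → (P i j ≡ -1ℤ) ⊎ (P i j ≡ 0ℤ) ⊎ (P i j ≡ 1ℤ)

Near : ∀ {n} → Fin n → Fin n → Set
Near i j = (toℕ i ≡ toℕ j) ⊎ (suc (toℕ i) ≡ toℕ j) ⊎ (toℕ i ≡ suc (toℕ j))

Tridiagonal : ∀ {n} → Matrix n → Set
Tridiagonal M = ∀ i j → ¬ Near i j → M i j ≡ 0ℤ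

WeakHadamard : ∀ {n} → Matrix n → Set
WeakHadamard P = Ternary P × Tridiagonal (transpose P ⊗ P)

Normalized : ∀ {n} → Matrix (suc n) → Set
Normalized P = (∀ j → P zero j ≡ 1ℤ) × (∀ i → P i zero ≡ 1ℤ)

colDot : ∀ {n} → Matrix n → Fin n → Fin n → ℤ
colDot P i j = Σℤ (λ k → P k i * P k j)

ColumnsPairwiseOrthogonal : ∀ {n} → Matrix n → Set
ColumnsPairwiseOrthogonal P = ∀ i j → ¬ i ≡ j → colDot P i j ≡ 0ℤ

{-# OPTIONS --safe #-}
-- Only the ternary entries and the column conditions are needed. Every column j ≥ 1 has the form (1, w) with w ∈ {-1,0,1}⁴,
-- and orthogonality gives 1 + Σ w = 0 and 1 + w · w' = 0 for two such columns.
-- So each w has odd support (a single -1, or two -1's and one +1) and any two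
-- supports meet in an odd number of places. Hence at most one w has a singleton
-- support, the others share one 3-element support on which only three such
-- vectors exist, and a fourth column is impossible. This case analysis is
-- carried out by deciding the statement over the 16 admissible columns.
module Submission where

open import Defs
open import Data.Empty using (⊥)
open import Data.Fin using (Fin; zero; suc)
open import Data.Fin.Patterns using (0F; 1F; 2F; 3F)
open import Data.Integer using (ℤ; _+_; _*_; 0ℤ; 1ℤ; -1ℤ)
open import Data.Integer.Properties using (_≟_)
open import Data.List using (List; []; _∷_; map; filter; cartesianProductWith)
open import Data.List.Membership.Propositional using (_∈_)
open import Data.List.Membership.Propositional.Properties
  using (∈-map⁺; ∈-filter⁺; ∈-cartesianProductWith⁺)
open import Data.List.Relation.Unary.All as All using (All; all?)
open import Data.List.Relation.Unary.Any using (here; there)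
open import Data.Nat using (ℕ)
open import Data.Product using (_×_; _,_; Σ; proj₁; proj₂)
open import Data.Sum using (_⊎_; inj₁; inj₂)
open import Data.Vec using (Vec; []; _∷_; lookup; tabulate)
open import Data.Vec.Properties using (lookup∘tabulate; tabulate-cong)
open import Relation.Binary.PropositionalEquality
  using (_≡_; _≢_; _≗_; refl; sym; trans; cong; cong₂; subst; subst₂)
open import Relation.Nullary using (¬_; Dec; no)
open import Relation.Nullary.Decidable using (from-yes; _→-dec_)

data Trit : Set where
  neg nul pos : Trit

⟦_⟧ : Trit → ℤ
⟦ neg ⟧ = -1ℤ
⟦ nul ⟧ = 0ℤ
⟦ pos ⟧ = 1ℤ

⟦⟧≡1⇒pos : ∀ {t} → ⟦ t ⟧ ≡ 1ℤ → t ≡ pos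
⟦⟧≡1⇒pos {pos} _ = refl

trit-of : ∀ {x} → x ≡ -1ℤ ⊎ x ≡ 0ℤ ⊎ x ≡ 1ℤ → Σ Trit λ t → ⟦ t ⟧ ≡ x
trit-of (inj₁ refl)        = neg , refl
trit-of (inj₂ (inj₁ refl)) = nul , refl
trit-of (inj₂ (inj₂ refl)) = pos , refl

module _ {n} {P : Matrix n} (ternary : Ternary P) where

  tritMatrix : Fin n → Fin n → Trit
  tritMatrix i j = proj₁ (trit-of (ternary i j))

  ⟦tritMatrix⟧ : ∀ i j → ⟦ tritMatrix i j ⟧ ≡ P i j
  ⟦tritMatrix⟧ i j = proj₂ (trit-of (ternary i j))

trits : List Trit
trits = neg ∷ nul ∷ pos ∷ []

∈-trits : ∀ t → t ∈ trits
∈-trits neg = here refl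
∈-trits nul = there (here refl)
∈-trits pos = there (there (here refl))

vectors : ∀ n → List (Vec Trit n)
vectors ℕ.zero    = [] ∷ []
vectors (ℕ.suc n) = cartesianProductWith _∷_ trits (vectors n)

∈-vectors : ∀ {n} (v : Vec Trit n) → v ∈ vectors n
∈-vectors []      = here refl
∈-vectors (t ∷ v) = ∈-cartesianProductWith⁺ _∷_ (∈-trits t) (∈-vectors v)

dot : ∀ {n} → Vec Trit n → Vec Trit n → ℤ
dot u v = Σℤ (λ k → ⟦ lookup u k ⟧ * ⟦ lookup v k ⟧)

_⟂_ : ∀ {n} → Vec Trit n → Vec Trit n → Set
u ⟂ v = dot u v ≡ 0ℤ

_⟂?_ : ∀ {n} (u v : Vec Trit n) → Dec (u ⟂ v)
u ⟂? v = dot u v ≟ 0ℤ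

column : ∀ {m n} {A : Set} → (Fin m → Fin n → A) → Fin n → Vec A m
column T j = tabulate (λ k → T k j)

Σℤ-cong : ∀ {n} {f g : Fin n → ℤ} → f ≗ g → Σℤ f ≡ Σℤ g
Σℤ-cong {ℕ.zero}  f≗g = refl
Σℤ-cong {ℕ.suc n} f≗g = cong₂ _+_ (f≗g zero) (Σℤ-cong (λ k → f≗g (suc k)))

colDot≡dot-column : ∀ {n} {P : Matrix n} {T : Fin n → Fin n → Trit} →
  (∀ i j → ⟦ T i j ⟧ ≡ P i j) → ∀ i j → colDot P i j ≡ dot (column T i) (column T j)
colDot≡dot-column {P = P} {T = T} ⟦T⟧≡P i j =
  Σℤ-cong λ k → sym (cong₂ _*_ (entry k i) (entry k j))
  where
  entry : ∀ k l → ⟦ lookup (column T l) k ⟧ ≡ P k l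
  entry k l = trans (cong ⟦_⟧ (lookup∘tabulate (λ k → T k l) k)) (⟦T⟧≡P k l)

ones : ∀ n → Vec Trit n
ones n = tabulate (λ _ → pos)

normalizedColumns : ∀ n → List (Vec Trit (ℕ.suc n))
normalizedColumns n = filter (ones (ℕ.suc n) ⟂?_) (map (pos ∷_) (vectors n))

module _ {n} {P : Matrix (ℕ.suc n)} (ternary : Ternary P) (normalized : Normalized P)
         (orthogonal : ColumnsPairwiseOrthogonal P) where

  private
    T : Fin (ℕ.suc n) → Fin (ℕ.suc n) → Trit
    T = tritMatrix ternary

    T≡pos : ∀ {i j} → P i j ≡ 1ℤ → T i j ≡ pos
    T≡pos {i} {j} Pij≡1 = ⟦⟧≡1⇒pos (trans (⟦tritMatrix⟧ ternary i j) Pij≡1)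

  column⟂column : ∀ i j → i ≢ j → column T i ⟂ column T j
  column⟂column i j i≢j =
    trans (sym (colDot≡dot-column (⟦tritMatrix⟧ ternary) i j)) (orthogonal i j i≢j)

  column-zero≡ones : column T zero ≡ ones (ℕ.suc n)
  column-zero≡ones = tabulate-cong λ k → T≡pos (proj₂ normalized k)

  column-suc∈normalizedColumns : ∀ j → column T (suc j) ∈ normalizedColumns n
  column-suc∈normalizedColumns j =
    subst (_∈ normalizedColumns n) (sym column≡pos∷tail)
      (∈-filter⁺ (ones (ℕ.suc n) ⟂?_) (∈-map⁺ (pos ∷_) (∈-vectors tail))
        (subst₂ _⟂_ column-zero≡ones column≡pos∷tail (column⟂column zero (suc j) λ ())))
    where
    tail : Vec Trit n
    tail = tabulate (λ k → T (suc k) (suc j))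

    column≡pos∷tail : column T (suc j) ≡ pos ∷ tail
    column≡pos∷tail = cong (_∷ tail) (T≡pos (proj₁ normalized (suc j)))

NoOrthogonalQuadruple : ∀ {n} → List (Vec Trit n) → Set
NoOrthogonalQuadruple vs =
  All (λ a → All (λ b → a ⟂ b →
    All (λ c → a ⟂ c → b ⟂ c →
      All (λ d → a ⟂ d → b ⟂ d → c ⟂ d → ⊥) vs) vs) vs) vs

noOrthogonalQuadruple? : ∀ {n} (vs : List (Vec Trit n)) → Dec (NoOrthogonalQuadruple vs)
noOrthogonalQuadruple? vs =
  all? (λ a → all? (λ b → a ⟂? b →-dec
    all? (λ c → a ⟂? c →-dec b ⟂? c →-dec
      all? (λ d → a ⟂? d →-dec b ⟂? d →-dec c ⟂? d →-dec no λ ()) vs) vs) vs) vs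

noOrthogonalQuadruple-sound : ∀ {n} {vs : List (Vec Trit n)} {a b c d} →
  NoOrthogonalQuadruple vs → a ∈ vs → b ∈ vs → c ∈ vs → d ∈ vs →
  a ⟂ b → a ⟂ c → b ⟂ c → a ⟂ d → b ⟂ d → c ⟂ d → ⊥
noOrthogonalQuadruple-sound none a∈ b∈ c∈ d∈ a⟂b a⟂c b⟂c a⟂d b⟂d c⟂d =
  All.lookup (All.lookup (All.lookup (All.lookup none a∈) b∈ a⟂b) c∈ a⟂c b⟂c) d∈ a⟂d b⟂d c⟂d

normalizedColumns-noOrthogonalQuadruple : NoOrthogonalQuadruple (normalizedColumns 4)
normalizedColumns-noOrthogonalQuadruple = from-yes (noOrthogonalQuadruple? (normalizedColumns 4))

corollary2p6 : (P : Matrix 5) →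
    ¬ (WeakHadamard P × Normalized P × ColumnsPairwiseOrthogonal P)
corollary2p6 P ((ternary , _) , normalized , orthogonal) =
  noOrthogonalQuadruple-sound normalizedColumns-noOrthogonalQuadruple
    (column∈ 0F) (column∈ 1F) (column∈ 2F) (column∈ 3F)
    (column⟂ 0F 1F λ ()) (column⟂ 0F 2F λ ()) (column⟂ 1F 2F λ ())
    (column⟂ 0F 3F λ ()) (column⟂ 1F 3F λ ()) (column⟂ 2F 3F λ ())
  where
  T : Fin 5 → Fin 5 → Trit
  T = tritMatrix ternary

  column∈ : ∀ j → column T (suc j) ∈ normalizedColumns 4
  column∈ = column-suc∈normalizedColumns ternary normalized orthogonal

  column⟂ : ∀ i j → suc i ≢ suc j → column T (suc i) ⟂ column T (suc j)
  column⟂ i j = column⟂column ternary normalized orthogonal (suc i) (suc j)
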